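{- For every nonnegative integer $g$, $$\pi_{2,6,6g+5}=\pi_{2,8,8g+7}=\pi_{2,12,12g+11}=\pi_{2,24,24g+23}=0.$$
   Context: For coprime positive integers $a_1,a_2$, let $g_{a_1,a_2}=a_1a_2-a_1-a_2$ and $$\pi_{2,a_1,a_2}=\#\{p \text{ prime}:\ p^2\le g_{a_1,a_2},\ p^2=a_1x_1+a_2x_2 \text{ for some } x_1,x_2\in\mathbb{Z}_{\ge0}\}.$$ -}

module Defs where

open import Data.Nat using (ℕ; zero; suc; _+_; _*_; _∸_; _^_; _≤_; _<_; z≤n; s≤s; NonZero)
open import Data.Nat.Properties using (_≟_; ≤-trans; m≤m+n; m≤n+m; m≤m*n; ≤-refl; n≤1+n; ≤-pred)
open import Data.Nat.Primality using (Prime; prime?)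
open import Data.List using (List; length; filter; upTo)
open import Data.Product using (∃₂; _,_; _×_; proj₁; proj₂)
open import Data.Sum using (_⊎_; inj₁; inj₂)
open import Relation.Nullary using (Dec; yes; no; ¬_)
open import Relation.Nullary.Decidable using (_×-dec_; map′)
open import Relation.Unary using (Decidable)
open import Relation.Binary.PropositionalEquality using (_≡_; refl; sym; subst)

-- Frobenius number g_{a1,a2} = a1 a2 - a1 - a2 (truncated subtraction in ℕ;
-- it is a genuine nonnegative value for all instances used in theorem8).
frob : ℕ → ℕ → ℕ
frob a₁ a₂ = a₁ * a₂ ∸ a₁ ∸ a₂

Representable : ℕ → ℕ → ℕ → Set
Representable a₁ a₂ n = ∃₂ λ x₁ x₂ → a₁ * x₁ + a₂ * x₂ ≡ n

private
  bound : ∀ a x n → .{{NonZero a}} → a * x ≤ n → x ≤ n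
  bound (suc a) x n le = ≤-trans (≤-trans (m≤m+n x (a * x)) ≤-refl) le

  Sol₂ : ℕ → ℕ → ℕ → ℕ → Set
  Sol₂ c a₂ n k = ∃₂ λ x₂ (_ : x₂ < k) → c + a₂ * x₂ ≡ n

  search₂ : ∀ c a₂ n k → Dec (Sol₂ c a₂ n k)
  search₂ c a₂ n zero = no λ { (_ , () , _) }
  search₂ c a₂ n (suc k) with c + a₂ * k ≟ n
  ... | yes eq = yes (k , ≤-refl , eq)
  ... | no neq with search₂ c a₂ n k
  ...   | yes (x , lt , eq) = yes (x , ≤-trans lt (n≤1+n _) , eq)
  ...   | no ¬s = no λ { (x , lt , eq) → step x lt eq }
    where
    step : ∀ x → x < suc k → c + a₂ * x ≡ n → _
    step x (s≤s lt) eq with x ≟ k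
    ... | yes refl = neq eq
    ... | no x≢k = ¬s (x , lt′ , eq)
      where
      open import Data.Nat.Properties using (≤∧≢⇒<)
      lt′ = ≤∧≢⇒< lt x≢k

  Sol : ℕ → ℕ → ℕ → ℕ → Set
  Sol a₁ a₂ n k = ∃₂ λ x₁ (_ : x₁ < k) → Sol₂ (a₁ * x₁) a₂ n (suc n)

  search : ∀ a₁ a₂ n k → Dec (Sol a₁ a₂ n k)
  search a₁ a₂ n zero = no λ { (_ , () , _) }
  search a₁ a₂ n (suc k) with search₂ (a₁ * k) a₂ n (suc n)
  ... | yes s = yes (k , ≤-refl , s)
  ... | no ns with search a₁ a₂ n k
  ...   | yes (x , lt , s) = yes (x , ≤-trans lt (n≤1+n _) , s)
  ...   | no ¬s = no λ { (x , lt , s) → step x lt s }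
    where
    step : ∀ x → x < suc k → Sol₂ (a₁ * x) a₂ n (suc n) → _
    step x (s≤s lt) s with x ≟ k
    ... | yes refl = ns s
    ... | no x≢k = ¬s (x , lt′ , s)
      where
      open import Data.Nat.Properties using (≤∧≢⇒<)
      lt′ = ≤∧≢⇒< lt x≢k

  le₁ : ∀ a b c → a + b ≡ c → a ≤ c
  le₁ a b c refl = m≤m+n a b

  le₂ : ∀ a b c → a + b ≡ c → b ≤ c
  le₂ a b c refl = m≤n+m b a

representable? : ∀ a₁ a₂ → .{{NonZero a₁}} → .{{NonZero a₂}} →
                 Decidable (Representable a₁ a₂)
representable? a₁ a₂ n = map′ to from (search a₁ a₂ n (suc n))
  where
  to : Sol a₁ a₂ n (suc n) → Representable a₁ a₂ n
  to (x₁ , _ , x₂ , _ , eq) = x₁ , x₂ , eq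
  from : Representable a₁ a₂ n → Sol a₁ a₂ n (suc n)
  from (x₁ , x₂ , eq) =
    x₁ , s≤s (bound a₁ x₁ n (le₁ _ _ _ eq)) ,
    x₂ , s≤s (bound a₂ x₂ n (le₂ _ _ _ eq)) , eq

-- π_{2,a₁,a₂} = #{ p prime : p² ≤ g_{a₁,a₂}, p² representable by a₁,a₂ }.
-- Any such p satisfies p ≤ p² ≤ g, so counting over p ∈ [0, g] is exhaustive.

CountedPrime : ℕ → ℕ → ℕ → Set
CountedPrime a₁ a₂ p = Prime p × (p ^ 2 ≤ frob a₁ a₂) × Representable a₁ a₂ (p ^ 2)

countedPrime? : ∀ a₁ a₂ → .{{NonZero a₁}} → .{{NonZero a₂}} →
                Decidable (CountedPrime a₁ a₂)
countedPrime? a₁ a₂ p =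
  prime? p ×-dec ((p ^ 2) Data.Nat.≤? frob a₁ a₂) ×-dec representable? a₁ a₂ (p ^ 2)
  where import Data.Nat

-- If a₁ = 0 or a₂ = 0 then g_{a₁,a₂} = 0 (truncated), and no prime p has
-- p² ≤ 0, so the count is 0; we return that value directly in those cases.
π₂ : (a₁ a₂ : ℕ) → ℕ
π₂ zero a₂ = 0
π₂ (suc a₁) zero = 0
π₂ a₁@(suc _) a₂@(suc _) =
  length (filter (countedPrime? a₁ a₂) (upTo (suc (frob a₁ a₂))))

-- Write a = 6, 8, 12 or 24 and b = a g + a - 1, so b ≡ -1 (mod a). If a prime
-- square p² = a x₁ + b x₂ lies below the Frobenius number a b - a - b, then
-- b x₂ ≤ p² forces x₂ ≤ a - 2, while p² ≡ -x₂ (mod a). Every prime p ≥ 5 has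
-- p² ≡ 1 (mod 24), hence modulo a, so a would divide 1 + x₂ ∈ [1, a - 1].
-- For p = 2, 3 the bound b x₂ ≤ p² < 2b leaves x₂ ≤ 1, and a would divide
-- 4, 9 or 10, none of which shares a divisor ≥ 6 with 24.
module Submission where

open import Defs
open import Data.Nat using (ℕ; zero; suc; _+_; _*_; _∸_; _^_; _≤_; _<_; _<?_; NonZero; _%_; _/_)
open import Data.Nat.Properties
open import Data.Nat.DivMod using (m≡m%n+[m/n]*n; m%n<n; %-distribˡ-*; m∣n⇒o%n%m≡o%m)
open import Data.Nat.Divisibility
  using (_∣_; divides; ∣-trans; ∣⇒≤; m∣m*n; n∣m*n; ∣m∣n⇒∣m+n; ∣m+n∣m⇒∣n; m%n≡0⇒n∣m)
open import Data.Nat.GCD using (gcd; gcd-greatest)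
open import Data.Nat.Primality using (Prime; prime⇒irreducible; prime⇒nonZero)
open import Data.Nat.Tactic.RingSolver using (solve)
open import Data.Fin using (Fin; toℕ; fromℕ<)
open import Data.Fin.Properties using (all?; toℕ-fromℕ<)
open import Data.List using (length; upTo; _∷_; [])
open import Data.List.Properties using (filter-none)
open import Data.List.Relation.Unary.All using (tabulate)
open import Data.Product using (_×_; _,_; ∃-syntax)
open import Data.Sum using (_⊎_; inj₁; inj₂)
open import Relation.Nullary using (¬_; yes; no; contradiction)
open import Relation.Nullary.Decidable using (_⊎-dec_; from-yes)
open import Relation.Binary.PropositionalEquality
  using (_≡_; _≢_; refl; sym; trans; cong; subst; module ≡-Reasoning)

representable-below-frob : ∀ {a b k n} → b + 1 ≡ a * k → 0 < n → n ≤ frob a b →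
  Representable a b n → ∃[ x₂ ] (b * x₂ ≤ n × 1 + x₂ < a × a ∣ n + x₂)
representable-below-frob {a} {b} {k} {n} b+1≡ak 0<n n≤g (x₁ , x₂ , ax₁+bx₂≡n) =
  x₂ , bx₂≤n , 1+x₂<a , a∣n+x₂
  where
  bx₂≤n : b * x₂ ≤ n
  bx₂≤n = subst (b * x₂ ≤_) ax₁+bx₂≡n (m≤n+m (b * x₂) (a * x₁))

  a∣n+x₂ : a ∣ n + x₂
  a∣n+x₂ = subst (a ∣_) n+x₂≡ (∣m∣n⇒∣m+n (m∣m*n x₁) (∣-trans (m∣m*n k) (m∣m*n x₂)))
    where
    n+x₂≡ : a * x₁ + a * k * x₂ ≡ n + x₂
    n+x₂≡ = begin
      a * x₁ + a * k * x₂     ≡⟨ cong (λ c → a * x₁ + c * x₂) (sym b+1≡ak) ⟩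
      a * x₁ + (b + 1) * x₂   ≡⟨ solve (a ∷ x₁ ∷ b ∷ x₂ ∷ []) ⟩
      a * x₁ + b * x₂ + x₂    ≡⟨ cong (_+ x₂) ax₁+bx₂≡n ⟩
      n + x₂                  ∎
      where open ≡-Reasoning

  n+a+b≤ab : n + (a + b) ≤ a * b
  n+a+b≤ab = m≤o∸n⇒m+n≤o n a+b≤ab n≤ab∸[a+b]
    where
    n≤ab∸[a+b] : n ≤ a * b ∸ (a + b)
    n≤ab∸[a+b] = subst (n ≤_) (∸-+-assoc (a * b) a b) n≤g
    a+b≤ab : a + b ≤ a * b
    a+b≤ab = <⇒≤ (m∸n≢0⇒n<m λ eq → <⇒≱ 0<n (subst (n ≤_) eq n≤ab∸[a+b]))

  1+x₂<a : 1 + x₂ < a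
  1+x₂<a with 1 + x₂ <? a
  ... | yes le = le
  ... | no ≮ = contradiction a≡0 a≢0
    where
    a≢0 : a ≢ 0
    a≢0 refl = 1+n≢0 (trans (+-comm 1 b) b+1≡ak)
    ba+a≤ba : b * a + a ≤ b * a + 0
    ba+a≤ba = begin
      b * a + a             ≤⟨ +-monoˡ-≤ a (*-monoʳ-≤ b (≮⇒≥ ≮)) ⟩
      b * suc x₂ + a        ≡⟨ cong (_+ a) (*-suc b x₂) ⟩
      b + b * x₂ + a        ≡⟨ solve (b ∷ x₂ ∷ a ∷ []) ⟩
      b * x₂ + (a + b)      ≤⟨ +-monoˡ-≤ (a + b) bx₂≤n ⟩
      n + (a + b)           ≤⟨ n+a+b≤ab ⟩
      a * b                 ≡⟨ solve (a ∷ b ∷ []) ⟩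
      b * a + 0             ∎
      where open ≤-Reasoning
    a≡0 : a ≡ 0
    a≡0 = n≤0⇒n≡0 (+-cancelˡ-≤ (b * a) a 0 ba+a≤ba)

prime≡2⊎≡3⊎coprime-to-6 : ∀ {p} → Prime p → p ≡ 2 ⊎ p ≡ 3 ⊎ (p % 2 ≢ 0 × p % 3 ≢ 0)
prime≡2⊎≡3⊎coprime-to-6 {p} pp with p ≟ 2 | p ≟ 3
... | yes p≡2 | _ = inj₁ p≡2
... | no _ | yes p≡3 = inj₂ (inj₁ p≡3)
... | no p≢2 | no p≢3 = inj₂ (inj₂ (∤ (λ ()) p≢2 , ∤ (λ ()) p≢3))
  where
  ∤ : ∀ {d} .{{_ : NonZero d}} → d ≢ 1 → p ≢ d → p % d ≢ 0
  ∤ {d} d≢1 p≢d p%d≡0 with prime⇒irreducible pp (m%n≡0⇒n∣m p d p%d≡0)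
  ... | inj₁ d≡1 = d≢1 d≡1
  ... | inj₂ d≡p = p≢d (sym d≡p)

residues-mod-24 : ∀ r → r < 24 → r % 2 ≡ 0 ⊎ r % 3 ≡ 0 ⊎ r * r % 24 ≡ 1
residues-mod-24 r r<24 = subst Good (toℕ-fromℕ< r<24) (check (fromℕ< r<24))
  where
  Good : ℕ → Set
  Good r = r % 2 ≡ 0 ⊎ r % 3 ≡ 0 ⊎ r * r % 24 ≡ 1
  check : ∀ (i : Fin 24) → Good (toℕ i)
  check = from-yes (all? {n = 24} λ i → let r = toℕ i in
    (r % 2 ≟ 0) ⊎-dec (r % 3 ≟ 0) ⊎-dec (r * r % 24 ≟ 1))

square%24≡1 : ∀ p → p % 2 ≢ 0 → p % 3 ≢ 0 → p ^ 2 % 24 ≡ 1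
square%24≡1 p p%2≢0 p%3≢0 with residues-mod-24 (p % 24) (m%n<n p 24)
... | inj₁ r%2≡0 =
  contradiction (trans (sym (m∣n⇒o%n%m≡o%m 2 24 p (divides 12 refl))) r%2≡0) p%2≢0
... | inj₂ (inj₁ r%3≡0) =
  contradiction (trans (sym (m∣n⇒o%n%m≡o%m 3 24 p (divides 8 refl))) r%3≡0) p%3≢0
... | inj₂ (inj₂ r²%24≡1) = begin
  p * (p * 1) % 24              ≡⟨ cong (λ q → p * q % 24) (*-identityʳ p) ⟩
  p * p % 24                    ≡⟨ %-distribˡ-* p p 24 ⟩
  p % 24 * (p % 24) % 24        ≡⟨ r²%24≡1 ⟩
  1                             ∎
  where open ≡-Reasoning

∣m+x⇒∣1+x : ∀ {d m n x} .{{_ : NonZero n}} → m % n ≡ 1 → d ∣ n → d ∣ m + x → d ∣ 1 + x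
∣m+x⇒∣1+x {d} {m} {n} {x} m%n≡1 d∣n d∣m+x =
  ∣m+n∣m⇒∣n (subst (d ∣_) m+x≡ d∣m+x) (∣-trans d∣n (n∣m*n (m / n)))
  where
  m+x≡ : m + x ≡ m / n * n + (1 + x)
  m+x≡ = begin
    m + x                     ≡⟨ cong (_+ x) (m≡m%n+[m/n]*n m n) ⟩
    m % n + m / n * n + x     ≡⟨ cong (λ r → r + m / n * n + x) m%n≡1 ⟩
    1 + m / n * n + x         ≡⟨ sym (+-suc (m / n * n) x) ⟩
    m / n * n + (1 + x)       ∎
    where open ≡-Reasoning

∣24∧∣⇒≤gcd : ∀ {a m} .{{_ : NonZero (gcd m 24)}} → a ∣ 24 → a ∣ m → a ≤ gcd m 24
∣24∧∣⇒≤gcd a∣24 a∣m = ∣⇒≤ (gcd-greatest a∣m a∣24)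

m+1≡n*o⇒n≤1+m : ∀ {m n o} → m + 1 ≡ n * o → n ≤ 1 + m
m+1≡n*o⇒n≤1+m {m} {n} {o} m+1≡no =
  ∣⇒≤ (divides o (trans (+-comm 1 m) (trans m+1≡no (*-comm n o))))

∣24∧∣4+x⇒⊥ : ∀ {a b x} → 6 ≤ a → a ∣ 24 → 5 ≤ b → b * x ≤ 4 → ¬ a ∣ 4 + x
∣24∧∣4+x⇒⊥ {x = zero} 6≤a a∣24 _ _ a∣4 =
  <⇒≱ 6≤a (≤-trans (∣24∧∣⇒≤gcd a∣24 a∣4) (n≤1+n 4))
∣24∧∣4+x⇒⊥ {b = b} {x = suc x} _ _ 5≤b b[1+x]≤4 _ =
  <⇒≱ (≤-trans 5≤b (m≤m*n b (suc x))) b[1+x]≤4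

∣24∧∣9+x⇒⊥ : ∀ {a b x} → 6 ≤ a → a ∣ 24 → 5 ≤ b → b * x ≤ 9 → ¬ a ∣ 9 + x
∣24∧∣9+x⇒⊥ {x = zero} 6≤a a∣24 _ _ a∣9 =
  <⇒≱ 6≤a (≤-trans (∣24∧∣⇒≤gcd a∣24 a∣9) (m≤m+n 3 2))
∣24∧∣9+x⇒⊥ {x = 1} 6≤a a∣24 _ _ a∣10 =
  <⇒≱ 6≤a (≤-trans (∣24∧∣⇒≤gcd a∣24 a∣10) (m≤m+n 2 3))
∣24∧∣9+x⇒⊥ {x = suc (suc x)} _ _ 5≤b b[2+x]≤9 _ =
  <⇒≱ (*-mono-≤ 5≤b (m≤m+n 2 x)) b[2+x]≤9

¬countedPrime : ∀ {a b k} → a ∣ 24 → 6 ≤ a → b + 1 ≡ a * k → ∀ p → ¬ CountedPrime a b p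
¬countedPrime a∣24 6≤a b+1≡ak p (pp , p²≤g , rep)
  with x₂ , bx₂≤p² , 1+x₂<a , a∣p²+x₂
         ← representable-below-frob b+1≡ak (m^n>0 p {{prime⇒nonZero pp}} 2) p²≤g rep
  with 5≤b ← ≤-pred (≤-trans 6≤a (m+1≡n*o⇒n≤1+m b+1≡ak))
  with prime≡2⊎≡3⊎coprime-to-6 pp
... | inj₁ refl = ∣24∧∣4+x⇒⊥ 6≤a a∣24 5≤b bx₂≤p² a∣p²+x₂
... | inj₂ (inj₁ refl) = ∣24∧∣9+x⇒⊥ 6≤a a∣24 5≤b bx₂≤p² a∣p²+x₂
... | inj₂ (inj₂ (p%2≢0 , p%3≢0)) =
  <⇒≱ 1+x₂<a (∣⇒≤ (∣m+x⇒∣1+x (square%24≡1 p p%2≢0 p%3≢0) a∣24 a∣p²+x₂))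

π₂≡0 : ∀ a b → (∀ p → ¬ CountedPrime a b p) → π₂ a b ≡ 0
π₂≡0 zero b _ = refl
π₂≡0 (suc a) zero _ = refl
π₂≡0 a@(suc _) b@(suc _) none =
  cong length (filter-none (countedPrime? a b) {xs = upTo (suc (frob a b))}
                           (tabulate λ {p} _ → none p))

∣24⇒π₂≡0 : ∀ {a b k} → a ∣ 24 → 6 ≤ a → b + 1 ≡ a * k → π₂ a b ≡ 0
∣24⇒π₂≡0 {a} {b} a∣24 6≤a b+1≡ak = π₂≡0 a b (¬countedPrime a∣24 6≤a b+1≡ak)

theorem8 : (g : ℕ) →
    (π₂ 6 (6 * g + 5) ≡ 0) × (π₂ 8 (8 * g + 7) ≡ 0) ×
    (π₂ 12 (12 * g + 11) ≡ 0) × (π₂ 24 (24 * g + 23) ≡ 0)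
theorem8 g =
  ∣24⇒π₂≡0 {k = suc g} (divides 4 refl) (m≤m+n 6 0) ([1+m]*g+m+1≡[1+m]*[1+g] 5) ,
  ∣24⇒π₂≡0 {k = suc g} (divides 3 refl) (m≤m+n 6 2) ([1+m]*g+m+1≡[1+m]*[1+g] 7) ,
  ∣24⇒π₂≡0 {k = suc g} (divides 2 refl) (m≤m+n 6 6) ([1+m]*g+m+1≡[1+m]*[1+g] 11) ,
  ∣24⇒π₂≡0 {k = suc g} (divides 1 refl) (m≤m+n 6 18) ([1+m]*g+m+1≡[1+m]*[1+g] 23)
  where
  [1+m]*g+m+1≡[1+m]*[1+g] : ∀ m → suc m * g + m + 1 ≡ suc m * suc g
  [1+m]*g+m+1≡[1+m]*[1+g] m = solve (m ∷ g ∷ [])
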